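{- Run the Uniform Budgeted Scheduler (UBS) described in the context, with a function $T$ satisfying the stated conditions and programs with halting times $\tau_j$. Let $(k,r)$ be a pair that UBS extracts and executes, with $T(k,r-1) < \tau_k$. Let $T_{\mathrm{UBS}}(k,r)$ be the total number of steps used by UBS (over all programs) after executing $(k,r)$, and for each $j \ge 1$ let $T_j(k,r) = \max\{T(j,m) : m \in \{0,1,2,\ldots\},\ T(j,m) \le T(k,r)\}$. Then $$T_{\mathrm{UBS}}(k,r) \le \sum_{j \ge 1} \min\{\tau_j, T_j(k,r)\}.$$
   Context: UBS runs programs indexed by $k \in \{1,2,\ldots\}$. Program $k$ halts when it has executed exactly $\tau_k \in \{1,2,\ldots\}\cup\{\infty\}$ steps in total; running program $k$ with budget $b$ resumes it from where it stopped and executes it for $b$ further steps or until it halts, whichever comes first. Let $T:\{1,2,\ldots\}\times\{0,1,2,\ldots\}\to\{0,1,2,\ldots\}$ satisfy $T(k,r) < T(k,r+1)$, $T(k,r) \le T(k+1,r)$ and $T(k,0) = 0$ for all $k,r$. UBS maintains a priority queue of pairs $(k,r)$ ordered by $T(k,r)$ (ties broken arbitrarily), initially containing $(1,1)$. While the queue is nonempty: extract a pair $(k,r)$ of minimal $T(k,r)$; run program $k$ with budget $T(k,r)-T(k,r-1)$ (its $r$-th segment); if program $k$ has not halted, insert $(k,r+1)$; if $r=1$, insert $(k+1,1)$. -}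

module Defs where

open import Data.Nat using (ℕ; zero; suc; _+_; _∸_; _⊓_; _≤_; _<_; _≡ᵇ_)
open import Data.Bool using (Bool; true; false; if_then_else_)
open import Data.List using (List; []; _∷_; [_]; _++_)
open import Data.List.Relation.Unary.All using (All)
open import Data.Product using (_×_; _,_; proj₁; proj₂; ∃)
open import Data.Unit using (⊤)
open import Relation.Binary.PropositionalEquality using (_≡_)

-- Halting times: {1,2,...} ∪ {∞} (positivity is a hypothesis of the theorem).
data Time : Set where
  fin : ℕ → Time
  ∞   : Time

minT : Time → ℕ → ℕ
minT (fin t) x = t ⊓ x
minT ∞       x = x

_<ᵗ_ : ℕ → Time → Set
n <ᵗ fin t = n < t
n <ᵗ ∞     = ⊤

sumFrom1 : (ℕ → ℕ) → ℕ → ℕ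
sumFrom1 f zero    = 0
sumFrom1 f (suc n) = sumFrom1 f n + f (suc n)

IsMaxBelow : (ℕ → ℕ → ℕ) → ℕ → ℕ → ℕ → Set
IsMaxBelow T j B v = (∃ λ m → T j m ≡ v × v ≤ B) × (∀ m → T j m ≤ B → T j m ≤ v)

-- Scheduler state: priority queue (as a list; extraction picks any minimal element),
-- number of steps executed so far by each program, total steps used by UBS.
record State : Set where
  constructor ⟨_,_,_⟩
  field
    queue : List (ℕ × ℕ)
    prog  : ℕ → ℕ
    used  : ℕ

initState : State
initState = ⟨ [ (1 , 1) ] , (λ _ → 0) , 0 ⟩

module UBS (T : ℕ → ℕ → ℕ) (τ : ℕ → Time) where

  -- position of program k after resuming from position p with budget b
  runTo : ℕ → ℕ → ℕ → ℕ
  runTo k p b with τ k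
  ... | fin t = t ⊓ (p + b)
  ... | ∞     = p + b

  halted : ℕ → ℕ → Bool
  halted k p with τ k
  ... | fin t = t ≡ᵇ p
  ... | ∞     = false

  budget : ℕ → ℕ → ℕ
  budget k r = T k r ∸ T k (r ∸ 1)

  update : (ℕ → ℕ) → ℕ → ℕ → (ℕ → ℕ)
  update f k v j = if j ≡ᵇ k then v else f j

  newPairs : ℕ → ℕ → Bool → List (ℕ × ℕ)
  newPairs k r h =
    (if h then [] else [ (k , suc r) ]) ++ (if r ≡ᵇ 1 then [ (suc k , 1) ] else [])

  data Step : State → ℕ × ℕ → State → Set where
    extract : ∀ {xs ys k r prog used} →
      All (λ p → T k r ≤ T (proj₁ p) (proj₂ p)) (xs ++ (k , r) ∷ ys) →
      Step ⟨ xs ++ (k , r) ∷ ys , prog , used ⟩ (k , r)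
           ⟨ xs ++ ys ++ newPairs k r (halted k (runTo k (prog k) (budget k r)))
           , update prog k (runTo k (prog k) (budget k r))
           , used + (runTo k (prog k) (budget k r) ∸ prog k) ⟩

  data Reach : State → Set where
    start : Reach initState
    next  : ∀ {s p s'} → Reach s → Step s p s' → Reach s'

-- UBS extracts pairs in nondecreasing order of T.  Hence, once (k,r) has run, every
-- program j stands at a position that is at most τ_j and at most some T(j,m) ≤ T(k,r),
-- and the steps used by UBS are the sum of these positions.  This becomes an invariant of
-- the execution once it is strengthened by the shape of the queue: every program has at
-- most one pair (j,r) in it, the position of j is at most T(j,r-1), and the programs beyond
-- the last one started, F, are still at position 0, the only first-round pair being F's.
module Submission where

open import Defs
open import Data.Bool using (true; false; if_then_else_)
open import Data.List using (List; []; _∷_; [_]; _++_)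
open import Data.List.Properties using (++-assoc)
open import Data.List.Relation.Unary.All as All using (All; []; _∷_)
import Data.List.Relation.Unary.All.Properties as All
open import Data.List.Relation.Unary.AllPairs using (AllPairs; []; _∷_)
import Data.List.Relation.Unary.AllPairs.Properties as AllPairs
open import Data.List.Relation.Binary.Permutation.Propositional using (↭⇒↭ₛ)
open import Data.List.Relation.Binary.Permutation.Propositional.Properties using (All-resp-↭; shift)
import Data.List.Relation.Binary.Permutation.Setoid.Properties as Permutationₛ
open import Data.Nat using (ℕ; zero; suc; _+_; _∸_; _≤_; _<_; _≡ᵇ_; z≤n; s≤s)
open import Data.Nat.Properties
open import Algebra.Properties.CommutativeSemigroup +-commutativeSemigroup using (xy∙z≈xz∙y)
open import Data.Product using (_×_; _,_; proj₁; proj₂; ∃; ∃₂; uncurry)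
open import Data.Sum using (inj₁; inj₂)
open import Data.Unit using (⊤; tt)
open import Function using (_on_)
open import Relation.Binary.PropositionalEquality
  using (_≡_; _≢_; refl; sym; trans; cong; cong₂; subst; resp₂; setoid; ≢-sym; module ≡-Reasoning)
open import Relation.Nullary using (contradiction; yes; no)
open import Relation.Unary using (Pred)
open import Relation.Binary using (Rel; Symmetric)

_≤ᵗ_ : ℕ → Time → Set
n ≤ᵗ fin t = n ≤ t
n ≤ᵗ ∞     = ⊤

z≤ᵗ : ∀ t → 0 ≤ᵗ t
z≤ᵗ (fin t) = z≤n
z≤ᵗ ∞       = tt

≤-minT : ∀ {p x} t → p ≤ᵗ t → p ≤ x → p ≤ minT t x
≤-minT (fin t) p≤t p≤x = ⊓-glb p≤t p≤x
≤-minT ∞       _   p≤x = p≤x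

sumFrom1-cong : ∀ {f g} n → (∀ j → j ≤ n → f j ≡ g j) → sumFrom1 f n ≡ sumFrom1 g n
sumFrom1-cong zero    _   = refl
sumFrom1-cong (suc n) f≗g =
  cong₂ _+_ (sumFrom1-cong n (λ j j≤n → f≗g j (m≤n⇒m≤1+n j≤n))) (f≗g (suc n) ≤-refl)

sumFrom1-mono-≤ : ∀ {f g} n → (∀ j → 1 ≤ j → f j ≤ g j) → sumFrom1 f n ≤ sumFrom1 g n
sumFrom1-mono-≤ zero    _   = z≤n
sumFrom1-mono-≤ (suc n) f≤g = +-mono-≤ (sumFrom1-mono-≤ n f≤g) (f≤g (suc n) (s≤s z≤n))

sumFrom1-zeros-beyond : ∀ {f m} n → (∀ j → m < j → f j ≡ 0) → m ≤ n →
                     sumFrom1 f n ≡ sumFrom1 f m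
sumFrom1-zeros-beyond zero _ z≤n = refl
sumFrom1-zeros-beyond {f} {m} (suc n) f≡0 m≤1+n with m≤n⇒m<n∨m≡n m≤1+n
... | inj₂ refl      = refl
... | inj₁ (s≤s m≤n) = begin
  sumFrom1 f n + f (suc n) ≡⟨ cong (sumFrom1 f n +_) (f≡0 (suc n) (s≤s m≤n)) ⟩
  sumFrom1 f n + 0         ≡⟨ +-identityʳ _ ⟩
  sumFrom1 f n             ≡⟨ sumFrom1-zeros-beyond n f≡0 m≤n ⟩
  sumFrom1 f m             ∎
  where open ≡-Reasoning

sumFrom1-raise : ∀ {f g k} n → (∀ j → j ≢ k → g j ≡ f j) → f k ≤ g k → 1 ≤ k → k ≤ n →
                 sumFrom1 g n ≡ sumFrom1 f n + (g k ∸ f k)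
sumFrom1-raise zero _ _ (s≤s _) ()
sumFrom1-raise {f} {g} {k} (suc n) g≗f fk≤gk 1≤k k≤1+n with m≤n⇒m<n∨m≡n k≤1+n
... | inj₂ refl = begin
  sumFrom1 g n + g k                  ≡⟨ cong (_+ g k) (sumFrom1-cong n λ j j≤n → g≗f j (<⇒≢ (s≤s j≤n))) ⟩
  sumFrom1 f n + g k                  ≡⟨ cong (sumFrom1 f n +_) (m+[n∸m]≡n fk≤gk) ⟨
  sumFrom1 f n + (f k + (g k ∸ f k))  ≡⟨ +-assoc (sumFrom1 f n) (f k) _ ⟨
  sumFrom1 f n + f k + (g k ∸ f k)    ∎
  where open ≡-Reasoning
... | inj₁ (s≤s k≤n) = begin
  sumFrom1 g n + g (suc n)                ≡⟨ cong₂ _+_ (sumFrom1-raise n g≗f fk≤gk 1≤k k≤n)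
                                                       (g≗f (suc n) (>⇒≢ (s≤s k≤n))) ⟩
  sumFrom1 f n + (g k ∸ f k) + f (suc n)  ≡⟨ xy∙z≈xz∙y (sumFrom1 f n) _ _ ⟩
  sumFrom1 f n + f (suc n) + (g k ∸ f k)  ∎
  where open ≡-Reasoning

All-optional : ∀ {a p} {A : Set a} {P : Pred A p} b {x} → P x → All P (if b then [] else [ x ])
All-optional true  _  = []
All-optional false px = px ∷ []

All-extract : ∀ {a p} {A : Set a} {P : Pred A p} xs {x ys} →
              All P (xs ++ x ∷ ys) → P x × All P (xs ++ ys)
All-extract xs {x} {ys} pxs with All-resp-↭ (shift x xs ys) pxs
... | px ∷ pxs′ = px , pxs′

AllPairs-extract : ∀ {a ℓ} {A : Set a} {R : Rel A ℓ} → Symmetric R → ∀ xs {x ys} →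
                   AllPairs R (xs ++ x ∷ ys) → All (R x) (xs ++ ys) × AllPairs R (xs ++ ys)
AllPairs-extract {A = A} sym xs {x} {ys} rxs
  with Permutationₛ.AllPairs-resp-↭ (setoid A) sym (resp₂ _) (↭⇒↭ₛ (shift x xs ys)) rxs
... | rx ∷ rxs′ = rx , rxs′

module Scheduler
  (T : ℕ → ℕ → ℕ) (τ : ℕ → Time)
  (T-strict : ∀ k r → T (suc k) r < T (suc k) (suc r))
  (T-mono   : ∀ k r → T (suc k) r ≤ T (suc (suc k)) r)
  (T-zero   : ∀ k → T (suc k) 0 ≡ 0)
  where

  open UBS T τ

  T-≤-suc : ∀ {j} → 1 ≤ j → ∀ r → T j r ≤ T j (suc r)
  T-≤-suc {suc j} _ r = <⇒≤ (T-strict j r)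

  T-pred-≤ : ∀ {j} → 1 ≤ j → ∀ r → T j (r ∸ 1) ≤ T j r
  T-pred-≤ _   zero    = ≤-refl
  T-pred-≤ 1≤j (suc r) = T-≤-suc 1≤j r

  T-≤-next : ∀ {j} → 1 ≤ j → ∀ r → T j r ≤ T (suc j) r
  T-≤-next {suc j} _ = T-mono j

  update-≡ : ∀ f k v → update f k v k ≡ v
  update-≡ f k v with k ≡ᵇ k | ≡⇒≡ᵇ k k refl
  ... | true  | _ = refl
  ... | false | ()

  update-≢ : ∀ f k v j → j ≢ k → update f k v j ≡ f j
  update-≢ f k v j j≢k with j ≡ᵇ k | ≡ᵇ⇒≡ j k
  ... | true  | j≡k = contradiction (j≡k tt) j≢k
  ... | false | _   = refl

  runTo-≤-+ : ∀ k p b → runTo k p b ≤ p + b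
  runTo-≤-+ k p b with τ k
  ... | fin t = m⊓n≤n t (p + b)
  ... | ∞     = ≤-refl

  ≤-runTo : ∀ k {p} b → p ≤ᵗ τ k → p ≤ runTo k p b
  ≤-runTo k {p} b with τ k
  ... | fin t = λ p≤t → ⊓-glb p≤t (m≤m+n p b)
  ... | ∞     = λ _ → m≤m+n p b

  runTo-≤ᵗ : ∀ k p b → runTo k p b ≤ᵗ τ k
  runTo-≤ᵗ k p b with τ k
  ... | fin t = m⊓n≤m t (p + b)
  ... | ∞     = tt

  runTo-budget-≤ : ∀ {k p} r → 1 ≤ k → p ≤ T k (r ∸ 1) → runTo k p (budget k r) ≤ T k r
  runTo-budget-≤ {k} {p} r 1≤k p≤ = begin
    runTo k p (budget k r)       ≤⟨ runTo-≤-+ k p (budget k r) ⟩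
    p + budget k r               ≤⟨ +-monoˡ-≤ (budget k r) p≤ ⟩
    T k (r ∸ 1) + budget k r     ≡⟨ m+[n∸m]≡n (T-pred-≤ 1≤k r) ⟩
    T k r                        ∎
    where open ≤-Reasoning

  -- L is the T-value of the pair extracted last and F the last program started.
  record Pending (prog : ℕ → ℕ) (L F : ℕ) (j r : ℕ) : Set where
    field
      index-pos   : 1 ≤ j
      index-≤     : j ≤ F
      round-pos   : 1 ≤ r
      first-round : r ≡ 1 → j ≡ F
      progress    : prog j ≤ T j (r ∸ 1)
      not-before  : L ≤ T j r

  record QueueInvariant (queue : List (ℕ × ℕ)) (prog : ℕ → ℕ) (L F : ℕ) : Set where
    field
      pending  : All (uncurry (Pending prog L F)) queue
      distinct : AllPairs (_≢_ on proj₁) queue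

  record ProgramInvariant (prog : ℕ → ℕ) (used L F : ℕ) : Set where
    field
      idle    : ∀ j → F < j → prog j ≡ 0
      used≡   : used ≡ sumFrom1 prog F
      reached : ∀ j → 1 ≤ j → ∃ λ m → prog j ≤ T j m × T j m ≤ L
      ≤τ      : ∀ j → prog j ≤ᵗ τ j

  Invariant : State → ℕ → ℕ → Set
  Invariant ⟨ queue , prog , used ⟩ L F =
    QueueInvariant queue prog L F × ProgramInvariant prog used L F

  Pending-after : ∀ {prog L F j r k r′} v → Pending prog L F j r → j ≢ k → T k r′ ≤ T j r →
                  Pending (update prog k v) (T k r′) F j r
  Pending-after {prog} {j = j} {k = k} v p j≢k later = record
    { index-pos   = index-pos
    ; index-≤     = index-≤
    ; round-pos   = round-pos
    ; first-round = first-round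
    ; progress    = subst (_≤ _) (sym (update-≢ prog k v j j≢k)) progress
    ; not-before  = later
    }
    where open Pending p

  Pending-advance : ∀ {prog L F j r} → Pending prog L F j r → j ≢ F → Pending prog L (suc F) j r
  Pending-advance p j≢F = record
    { index-pos   = index-pos
    ; index-≤     = m≤n⇒m≤1+n index-≤
    ; round-pos   = round-pos
    ; first-round = λ r≡1 → contradiction (first-round r≡1) j≢F
    ; progress    = progress
    ; not-before  = not-before
    }
    where open Pending p

  Pending-next-round : ∀ {prog F k r} → 1 ≤ k → k ≤ F → 1 ≤ r → prog k ≤ T k r →
                       Pending prog (T k r) F k (suc r)
  Pending-next-round {k = k} {suc r} 1≤k k≤F (s≤s z≤n) prog≤ = record
    { index-pos   = 1≤k
    ; index-≤     = k≤F
    ; round-pos   = s≤s z≤n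
    ; first-round = λ ()
    ; progress    = prog≤
    ; not-before  = T-≤-suc 1≤k (suc r)
    }

  Pending-first-round : ∀ {prog k} → 1 ≤ k → prog (suc k) ≡ 0 → Pending prog (T k 1) (suc k) (suc k) 1
  Pending-first-round {k = k} 1≤k idle = record
    { index-pos   = s≤s z≤n
    ; index-≤     = ≤-refl
    ; round-pos   = ≤-refl
    ; first-round = λ _ → refl
    ; progress    = subst (_≤ T (suc k) 0) (sym idle) z≤n
    ; not-before  = T-≤-next 1≤k 1
    }

  All-newPairs : ∀ {p} {P : Pred (ℕ × ℕ) p} k r h →
                 P (k , suc r) → (r ≡ 1 → P (suc k , 1)) → All P (newPairs k r h)
  All-newPairs k r h p-next p-first with r ≡ᵇ 1 | ≡ᵇ⇒≡ r 1
  ... | true  | r≡1 = All.++⁺ (All-optional h p-next) (p-first (r≡1 tt) ∷ [])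
  ... | false | _   = All.++⁺ (All-optional h p-next) []

  AllPairs-newPairs : ∀ k r h → AllPairs (_≢_ on proj₁) (newPairs k r h)
  AllPairs-newPairs k r h with h | r ≡ᵇ 1
  ... | true  | true  = [] ∷ []
  ... | true  | false = []
  ... | false | true  = (<⇒≢ (n<1+n k) ∷ []) ∷ [] ∷ []
  ... | false | false = [] ∷ []

  QueueInvariant-++ : ∀ {xs ys prog L F} → QueueInvariant xs prog L F → QueueInvariant ys prog L F →
                      All (λ x → All (λ y → proj₁ x ≢ proj₁ y) ys) xs →
                      QueueInvariant (xs ++ ys) prog L F
  QueueInvariant-++ Qxs Qys fresh = record
    { pending  = All.++⁺ (QueueInvariant.pending Qxs) (QueueInvariant.pending Qys)
    ; distinct = AllPairs.++⁺ (QueueInvariant.distinct Qxs) (QueueInvariant.distinct Qys) fresh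
    }

  QueueInvariant-newPairs : ∀ {prog L F k r} h → Pending prog L F k (suc r) →
                            (r ≡ 1 → Pending prog L F (suc k) 1) →
                            QueueInvariant (newPairs k r h) prog L F
  QueueInvariant-newPairs {k = k} {r} h p-next p-first = record
    { pending  = All-newPairs k r h p-next p-first
    ; distinct = AllPairs-newPairs k r h
    }

  newPairs-fresh : ∀ {prog L F j r′ k r} h → Pending prog L F j r′ → j ≢ k → (r ≡ 1 → k ≡ F) →
                   All (λ y → j ≢ proj₁ y) (newPairs k r h)
  newPairs-fresh {k = k} {r} h p j≢k k≡F = All-newPairs k r h j≢k λ r≡1 →
    <⇒≢ (s≤s (≤-trans (Pending.index-≤ p) (≤-reflexive (sym (k≡F r≡1)))))

  QueueInvariant-extract : ∀ {prog L F} xs {x ys} → QueueInvariant (xs ++ x ∷ ys) prog L F →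
                           uncurry (Pending prog L F) x × All (λ z → proj₁ x ≢ proj₁ z) (xs ++ ys) ×
                           QueueInvariant (xs ++ ys) prog L F
  QueueInvariant-extract xs Q with All-extract xs (QueueInvariant.pending Q)
                                 | AllPairs-extract ≢-sym xs (QueueInvariant.distinct Q)
  ... | px , pending | x-fresh , distinct = px , x-fresh , record { pending = pending ; distinct = distinct }

  QueueInvariant-update :
    ∀ {zs prog L F F′ k r} v → QueueInvariant zs prog L F →
    All (λ z → k ≢ proj₁ z) zs → All (λ z → T k r ≤ T (proj₁ z) (proj₂ z)) zs →
    (∀ {j r′} → Pending prog L F j r′ → j ≢ k → Pending prog L F′ j r′) →
    QueueInvariant zs (update prog k v) (T k r) F′
  QueueInvariant-update v Q k-fresh later keep = record
    { pending  = All.zipWith (λ ((p , k≢j) , T≤) → Pending-after v (keep p (≢-sym k≢j)) (≢-sym k≢j) T≤)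
                             (All.zip (QueueInvariant.pending Q , k-fresh) , later)
    ; distinct = QueueInvariant.distinct Q
    }

  QueueInvariant-step :
    ∀ {prog L F F′ k r} xs {ys} v h →
    QueueInvariant (xs ++ (k , r) ∷ ys) prog L F →
    All (λ z → T k r ≤ T (proj₁ z) (proj₂ z)) (xs ++ (k , r) ∷ ys) →
    (∀ {j r′} → Pending prog L F j r′ → j ≢ k → Pending prog L F′ j r′) →
    QueueInvariant (newPairs k r h) (update prog k v) (T k r) F′ →
    QueueInvariant (xs ++ ys ++ newPairs k r h) (update prog k v) (T k r) F′
  QueueInvariant-step {k = k} {r} xs {ys} v h Q minimal keep Qnew
    with QueueInvariant-extract xs Q
  ... | pk , k-fresh , Qrest =
    subst (λ q → QueueInvariant q _ _ _) (++-assoc xs ys (newPairs k r h))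
      (QueueInvariant-++ (QueueInvariant-update v Qrest k-fresh later keep) Qnew cross)
    where
    later : All (λ z → T k r ≤ T (proj₁ z) (proj₂ z)) (xs ++ ys)
    later = proj₂ (All-extract xs minimal)
    cross : All (λ z → All (λ y → proj₁ z ≢ proj₁ y) (newPairs k r h)) (xs ++ ys)
    cross = All.zipWith (λ (p , k≢j) → newPairs-fresh h p (≢-sym k≢j) (Pending.first-round pk))
                        (QueueInvariant.pending Qrest , k-fresh)

  run-segment-≤ : ∀ {prog L F k r} → Pending prog L F k r →
                update prog k (runTo k (prog k) (budget k r)) k ≤ T k r
  run-segment-≤ {prog} {k = k} {r} p =
    subst (_≤ T k r) (sym (update-≡ prog k _)) (runTo-budget-≤ r index-pos progress)
    where open Pending p

  ProgramInvariant-step :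
    ∀ {prog used L F F′ k r} → ProgramInvariant prog used L F → Pending prog L F k r → F ≤ F′ →
    let v = runTo k (prog k) (budget k r) in
    ProgramInvariant (update prog k v) (used + (v ∸ prog k)) (T k r) F′
  ProgramInvariant-step {prog} {used} {L} {F} {F′} {k} {r} P p F≤F′ = record
    { idle    = idle′
    ; used≡   = used≡′
    ; reached = reached′
    ; ≤τ      = ≤τ′
    }
    where
    open ProgramInvariant P
    open Pending p using (index-pos; index-≤; not-before)
    v : ℕ
    v = runTo k (prog k) (budget k r)
    prog′ : ℕ → ℕ
    prog′ = update prog k v
    k≤F′ : k ≤ F′
    k≤F′ = ≤-trans index-≤ F≤F′

    idle′ : ∀ j → F′ < j → prog′ j ≡ 0
    idle′ j F′<j = trans (update-≢ prog k v j (>⇒≢ (≤-<-trans k≤F′ F′<j)))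
                         (idle j (≤-<-trans F≤F′ F′<j))

    used≡′ : used + (v ∸ prog k) ≡ sumFrom1 prog′ F′
    used≡′ = begin
      used + (v ∸ prog k)                       ≡⟨ cong (_+ (v ∸ prog k)) used≡ ⟩
      sumFrom1 prog F + (v ∸ prog k)            ≡⟨ cong (_+ (v ∸ prog k)) (sumFrom1-zeros-beyond F′ idle F≤F′) ⟨
      sumFrom1 prog F′ + (v ∸ prog k)           ≡⟨ cong (λ w → sumFrom1 prog F′ + (w ∸ prog k)) (update-≡ prog k v) ⟨
      sumFrom1 prog F′ + (prog′ k ∸ prog k)     ≡⟨ sumFrom1-raise F′ (update-≢ prog k v) prog≤ index-pos k≤F′ ⟨
      sumFrom1 prog′ F′                         ∎
      where
      open ≡-Reasoning
      prog≤ : prog k ≤ prog′ k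
      prog≤ = subst (prog k ≤_) (sym (update-≡ prog k v)) (≤-runTo k (budget k r) (≤τ k))

    reached′ : ∀ j → 1 ≤ j → ∃ λ m → prog′ j ≤ T j m × T j m ≤ T k r
    reached′ j 1≤j with j ≟ k
    ... | yes refl = r , run-segment-≤ p , ≤-refl
    ... | no j≢k with reached j 1≤j
    ...   | m , prog≤ , T≤L =
      m , subst (_≤ T j m) (sym (update-≢ prog k v j j≢k)) prog≤ , ≤-trans T≤L not-before

    ≤τ′ : ∀ j → prog′ j ≤ᵗ τ j
    ≤τ′ j with j ≟ k
    ... | yes refl = subst (_≤ᵗ τ k) (sym (update-≡ prog k v)) (runTo-≤ᵗ k (prog k) (budget k r))
    ... | no j≢k   = subst (_≤ᵗ τ j) (sym (update-≢ prog k v j j≢k)) (≤τ j)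

  step-preserves : ∀ {s s′ k r L F} → Invariant s L F → Step s (k , r) s′ →
                   ∃ λ F′ → Invariant s′ (T k r) F′
  step-preserves {r = zero} (Q , _) (extract {xs} _)
    with Pending.round-pos (proj₁ (QueueInvariant-extract xs Q))
  ... | ()
  step-preserves {k = k} {r = suc zero} (Q , P) (extract {xs} {prog = prog} minimal)
    with QueueInvariant-extract xs Q
  ... | pk , _ with Pending.first-round pk refl
  ... | refl =
    suc k , QueueInvariant-step xs v (halted k v) Q minimal Pending-advance Qnew
          , ProgramInvariant-step P pk (n≤1+n k)
    where
    open Pending pk using (index-pos)
    v : ℕ
    v = runTo k (prog k) (budget k 1)
    next-idle : update prog k v (suc k) ≡ 0
    next-idle = trans (update-≢ prog k v (suc k) (>⇒≢ (n<1+n k)))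
                      (ProgramInvariant.idle P (suc k) (n<1+n k))
    Qnew : QueueInvariant (newPairs k 1 (halted k v)) (update prog k v) (T k 1) (suc k)
    Qnew = QueueInvariant-newPairs (halted k v)
      (Pending-next-round index-pos (n≤1+n k) ≤-refl (run-segment-≤ pk))
      (λ _ → Pending-first-round index-pos next-idle)
  step-preserves {k = k} {r = suc (suc r)} {F = F} (Q , P) (extract {xs} {prog = prog} minimal)
    with QueueInvariant-extract xs Q
  ... | pk , _ =
    F , QueueInvariant-step xs v (halted k v) Q minimal (λ p _ → p) Qnew
      , ProgramInvariant-step P pk ≤-refl
    where
    open Pending pk using (index-pos; index-≤)
    v : ℕ
    v = runTo k (prog k) (budget k (suc (suc r)))
    Qnew : QueueInvariant (newPairs k (suc (suc r)) (halted k v)) (update prog k v) (T k (suc (suc r))) F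
    Qnew = QueueInvariant-newPairs (halted k v)
      (Pending-next-round index-pos index-≤ (s≤s z≤n) (run-segment-≤ pk)) λ ()

  initial-invariant : Invariant initState 0 1
  initial-invariant = queue , programs
    where
    queue : QueueInvariant [ (1 , 1) ] (λ _ → 0) 0 1
    queue = record
      { pending  = record
        { index-pos   = ≤-refl
        ; index-≤     = ≤-refl
        ; round-pos   = ≤-refl
        ; first-round = λ _ → refl
        ; progress    = z≤n
        ; not-before  = z≤n
        } ∷ []
      ; distinct = [] ∷ []
      }
    programs : ProgramInvariant (λ _ → 0) 0 0 1
    programs = record
      { idle    = λ _ _ → refl
      ; used≡   = refl
      ; reached = λ { (suc j) _ → 0 , z≤n , ≤-reflexive (T-zero j) }
      ; ≤τ      = λ j → z≤ᵗ (τ j)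
      }

  reachable-invariant : ∀ {s} → Reach s → ∃₂ λ L F → Invariant s L F
  reachable-invariant start = 0 , 1 , initial-invariant
  reachable-invariant (next {p = k , r} reach step) =
    T k r , step-preserves (proj₂ (proj₂ (reachable-invariant reach))) step

  used-≤-sum : ∀ {prog used L F} (Tj : ℕ → ℕ) → ProgramInvariant prog used L F →
               (∀ j → 1 ≤ j → IsMaxBelow T j L (Tj j)) →
               used ≤ sumFrom1 (λ j → minT (τ j) (Tj j)) F
  used-≤-sum {prog} {used} {F = F} Tj P Tj-max = begin
    used                                   ≡⟨ used≡ ⟩
    sumFrom1 prog F                        ≤⟨ sumFrom1-mono-≤ F bound ⟩
    sumFrom1 (λ j → minT (τ j) (Tj j)) F  ∎
    where
    open ProgramInvariant P
    open ≤-Reasoning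
    bound : ∀ j → 1 ≤ j → prog j ≤ minT (τ j) (Tj j)
    bound j 1≤j with reached j 1≤j
    ... | m , prog≤ , T≤L = ≤-minT (τ j) (≤τ j) (≤-trans prog≤ (proj₂ (Tj-max j 1≤j) m T≤L))

theorem2 : (T : ℕ → ℕ → ℕ) (τ : ℕ → Time) →
    (∀ k r → T (suc k) r < T (suc k) (suc r)) →
    (∀ k r → T (suc k) r ≤ T (suc (suc k)) r) →
    (∀ k → T (suc k) 0 ≡ 0) →
    (∀ k → τ (suc k) ≢ fin 0) →
    ∀ {s s' k r} → UBS.Reach T τ s → UBS.Step T τ s (k , r) s' →
    T k (r ∸ 1) <ᵗ τ k →
    (Tj : ℕ → ℕ) → (∀ j → 1 ≤ j → IsMaxBelow T j (T k r) (Tj j)) →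
    ∃ λ N → State.used s' ≤ sumFrom1 (λ j → minT (τ j) (Tj j)) N
theorem2 T τ T-strict T-mono T-zero _ reach step _ Tj Tj-max =
  let _ , _ , I = reachable-invariant reach
      F , _ , P = step-preserves I step
  in  F , used-≤-sum Tj P Tj-max
  where open Scheduler T τ T-strict T-mono T-zero
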